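{- Let $G$ be a connected graph with $n$ vertices and let $k$ be a nonnegative integer with $k<n$. Then $G$ is an $(n-k)$-competition graph if and only if $G/\!\!\sim$ is isomorphic to an induced subgraph of $\Psi_{n,k}$.
   Context: All graphs are finite and simple. For a positive integer $p$ and a digraph $D=(V,A)$ with $A\subseteq V\times V$ (loops allowed), the $p$-competition graph $C_p(D)$ has vertex set $V$, and distinct $x,y$ are adjacent iff there are $p$ distinct vertices $a_1,\dots,a_p\in V$ with $(x,a_i),(y,a_i)\in A$ for all $i$. A graph is a $p$-competition graph if it equals $C_p(D)$ for some digraph $D$. Two vertices $u,v$ of $G$ are homogeneous ($u\sim v$) if $N_G[u]=N_G[v]$ (closed neighborhoods); the condensation $G/\!\!\sim$ has the equivalence classes $[u]$ as vertices, with $[u][v]$ an edge iff $[u]\neq[v]$ and $uv\in E(G)$. For a positive integer $n$ and nonnegative integer $k\le n$, $\Psi_{n,k}$ is the simple graph with vertex set the power set of $\{1,\dots,n\}$ in which distinct subsets $S,T$ are adjacent iff $|S\cup T|\le k$. -}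

module Defs where

open import Data.Nat using (ℕ; _≤_; _<_; _∸_)
open import Data.Bool using (Bool; true; false)
open import Data.Fin using (Fin; toℕ)
open import Data.Fin.Subset using (Subset; _∪_; ∣_∣)
open import Data.Product using (Σ; _×_; proj₁)
open import Data.Sum using (_⊎_)
open import Function.Bundles using (_⇔_)
open import Function.Definitions using (Injective)
open import Relation.Binary.PropositionalEquality using (_≡_; _≢_)

record Graph (n : ℕ) : Set where
  field
    adj    : Fin n → Fin n → Bool
    sym    : ∀ x y → adj x y ≡ adj y x
    irrefl : ∀ x → adj x x ≡ false

open Graph public

Adj : ∀ {n} → Graph n → Fin n → Fin n → Set
Adj G x y = adj G x y ≡ true

data Reach {n : ℕ} (G : Graph n) : Fin n → Fin n → Set where
  here : ∀ {u} → Reach G u u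
  step : ∀ {u v w} → Adj G u v → Reach G v w → Reach G u w

Connected : ∀ {n} → Graph n → Set
Connected G = ∀ u v → Reach G u v

Digraph : ℕ → Set
Digraph n = Fin n → Fin n → Bool

Arc : ∀ {n} → Digraph n → Fin n → Fin n → Set
Arc D x y = D x y ≡ true

CompAdj : ∀ {n} → ℕ → Digraph n → Fin n → Fin n → Set
CompAdj {n} p D x y =
  x ≢ y × Σ (Fin p → Fin n) (λ a → Injective _≡_ _≡_ a × (∀ i → Arc D x (a i) × Arc D y (a i)))

IsCompetitionGraph : ∀ {n} → ℕ → Graph n → Set
IsCompetitionGraph {n} p G = Σ (Digraph n) (λ D → ∀ x y → Adj G x y ⇔ CompAdj p D x y)

ClosedNbr : ∀ {n} → Graph n → Fin n → Fin n → Set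
ClosedNbr G u w = w ≡ u ⊎ Adj G u w

Homogeneous : ∀ {n} → Graph n → Fin n → Fin n → Set
Homogeneous G u v = ∀ w → ClosedNbr G u w ⇔ ClosedNbr G v w

-- Vertices of the condensation G/~ : each class [v] represented by its
-- least element (w.r.t. the order of Fin n).
IsRep : ∀ {n} → Graph n → Fin n → Set
IsRep G v = ∀ u → Homogeneous G u v → toℕ v ≤ toℕ u

Class : ∀ {n} → Graph n → Set
Class {n} G = Σ (Fin n) (IsRep G)

CondAdj : ∀ {n} (G : Graph n) → Class G → Class G → Set
CondAdj G c d = proj₁ c ≢ proj₁ d × Adj G (proj₁ c) (proj₁ d)

PsiAdj : (n k : ℕ) → Subset n → Subset n → Set
PsiAdj n k S T = S ≢ T × ∣ S ∪ T ∣ ≤ k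

CondEmbedsInPsi : ∀ {n} → Graph n → ℕ → Set
CondEmbedsInPsi {n} G k =
  Σ (Class G → Subset n) (λ ψ →
      (∀ c d → ψ c ≡ ψ d → proj₁ c ≡ proj₁ d)
    × (∀ c d → CondAdj G c d ⇔ PsiAdj n k (ψ c) (ψ d)))

-- Distinct x and y are adjacent in C_{n−k}(D) iff their out-neighbourhoods
-- share at least n − k vertices, i.e. iff the complements S x and S y of these
-- out-neighbourhoods satisfy |S x ∪ S y| ≤ k. So G is an (n−k)-competition
-- graph iff it has a Ψ_{n,k}-labelling: a map S with xy ∈ E(G) ⇔ x ≠ y ∧
-- |S x ∪ S y| ≤ k, distinct vertices being allowed to share a label. In a
-- connected graph with at least two vertices every vertex has a neighbour, so
-- every label has at most k elements, and then vertices with equal labels have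
-- equal closed neighbourhoods: S restricted to the class representatives embeds
-- G/∼ into Ψ_{n,k}. Conversely, labelling each vertex by the image of its class
-- is a Ψ_{n,k}-labelling, because non-homogeneous vertices are adjacent exactly
-- when their classes are.
module Submission where

open import Defs hiding (sym)
open import Data.Nat using (ℕ; _<_; _∸_)
open import Function.Bundles using (_⇔_)

open import Data.Bool using (Bool; true)
import Data.Bool.Properties as Bool
open import Data.Bool.Properties using (T-irrelevant)
open import Data.Fin using (Fin; zero; suc; inject≤; toℕ; _≟_; fromℕ<)
open import Data.Fin.Properties
  using (suc-injective; injective⇒≤; inject≤-injective; toℕ-injective; toℕ-inject; toℕ-fromℕ<; ¬∀⟶∃¬-smallest; all?)
open import Data.Fin.Subset using (Subset; inside; outside; ⊥; _∈_; _∉_; ∁; _∪_; ∣_∣)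
open import Data.Fin.Subset.Properties
  using (∣p∣≤n; ∣∁p∣≡n∸∣p∣; x∈∁p⇒x∉p; x∉p⇒x∈∁p; x∈p⇒x∉∁p; x∉∁p⇒x∈p; x∈p∪q⁺; x∈p∪q⁻; ∣p∣≤∣p∪q∣; ∪-idem; ∣⊥∣≡0)
open import Data.Nat using (_≤_; _≤?_; z≤n)
open import Data.Nat.Properties using (∸-monoʳ-≤; ∸-monoʳ-<; ≮⇒≥; <⇒≱; ≤-antisym; ≤-trans)
open import Data.Product using (Σ; _×_; _,_; proj₁; proj₂)
open import Data.Product.Function.NonDependent.Propositional using (_×-⇔_)
open import Data.Sum using (inj₁; inj₂; [_,_]′)
open import Data.Vec using (_∷_; lookup; tabulate; here; there)
open import Data.Vec.Properties using ([]=⇒lookup; lookup⇒[]=; lookup∘tabulate)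
open import Function using (_∘_)
open import Function.Bundles using (mk⇔; Equivalence)
open import Function.Definitions using (Injective)
open import Function.Properties.Equivalence using () renaming (refl to ⇔-refl; sym to ⇔-sym; trans to ⇔-trans)
open import Function.Related.Propositional using (module EquationalReasoning)
open import Relation.Binary.PropositionalEquality
  using (_≡_; _≢_; refl; sym; trans; cong; cong₂; subst; module ≡-Reasoning)
open import Relation.Nullary.Decidable
  using (Dec; yes; no; map′; _×-dec_; _⊎-dec_; _→-dec_; ¬?; decidable-stable; toSum; toWitness; fromWitness)
open import Relation.Nullary.Negation using (¬_; _¬-⊎_; contradiction)
open import Relation.Unary using (Pred; Decidable)

open Equivalence using (to; from)

private
  variable
    n : ℕ

_⇔?_ : ∀ {a b} {A : Set a} {B : Set b} → Dec A → Dec B → Dec (A ⇔ B)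
A? ⇔? B? = map′ (λ (f , g) → mk⇔ f g) (λ e → to e , from e) ((A? →-dec B?) ×-dec (B? →-dec A?))

×⇔proj₂ : ∀ {a b} {A : Set a} {B : Set b} → A → (A × B) ⇔ B
×⇔proj₂ a = mk⇔ proj₂ (a ,_)

leastWitness : ∀ {p} (P : Pred (Fin n) p) → Decidable P → ∀ {x} → P x →
  Σ (Fin n) λ i → P i × ∀ u → P u → toℕ i ≤ toℕ u
leastWitness {n} P P? Px with ¬∀⟶∃¬-smallest n (λ i → ¬ P i) (¬? ∘ P?) (λ ¬P → ¬P _ Px)
... | i , ¬¬Pi , ¬P-below = i , decidable-stable (P? i) ¬¬Pi , minimal
  where
  minimal : ∀ u → P u → toℕ i ≤ toℕ u
  minimal u Pu = ≮⇒≥ λ u<i → ¬P-below (fromℕ< u<i)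
    (subst P (sym (toℕ-injective (trans (toℕ-inject (fromℕ< u<i)) (toℕ-fromℕ< u<i)))) Pu)

enumerate : (p : Subset n) → Fin ∣ p ∣ → Fin n
enumerate (inside  ∷ p) zero    = zero
enumerate (inside  ∷ p) (suc i) = suc (enumerate p i)
enumerate (outside ∷ p) i       = suc (enumerate p i)

enumerate-injective : (p : Subset n) → Injective _≡_ _≡_ (enumerate p)
enumerate-injective (inside  ∷ p) {zero}  {zero}  _  = refl
enumerate-injective (inside  ∷ p) {suc i} {suc j} eq = cong suc (enumerate-injective p (suc-injective eq))
enumerate-injective (outside ∷ p) eq = enumerate-injective p (suc-injective eq)

enumerate-∈ : (p : Subset n) (i : Fin ∣ p ∣) → enumerate p i ∈ p
enumerate-∈ (inside  ∷ p) zero    = here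
enumerate-∈ (inside  ∷ p) (suc i) = there (enumerate-∈ p i)
enumerate-∈ (outside ∷ p) i       = there (enumerate-∈ p i)

index : ∀ {p : Subset n} {x} → x ∈ p → Fin ∣ p ∣
index {p = inside  ∷ p} here        = zero
index {p = inside  ∷ p} (there x∈p) = suc (index x∈p)
index {p = outside ∷ p} (there x∈p) = index x∈p

enumerate-index : ∀ {p : Subset n} {x} (x∈p : x ∈ p) → enumerate p (index x∈p) ≡ x
enumerate-index {p = inside  ∷ p} here        = refl
enumerate-index {p = inside  ∷ p} (there x∈p) = cong suc (enumerate-index x∈p)
enumerate-index {p = outside ∷ p} (there x∈p) = cong suc (enumerate-index x∈p)

index-injective : ∀ {p : Subset n} {x y} (x∈p : x ∈ p) (y∈p : y ∈ p) → index x∈p ≡ index y∈p → x ≡ y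
index-injective {p = p} {x} {y} x∈p y∈p eq = begin
  x                        ≡⟨ enumerate-index x∈p ⟨
  enumerate p (index x∈p)  ≡⟨ cong (enumerate p) eq ⟩
  enumerate p (index y∈p)  ≡⟨ enumerate-index y∈p ⟩
  y                        ∎
  where open ≡-Reasoning

DistinctElems : ℕ → (Fin n → Set) → Set
DistinctElems {n} m P = Σ (Fin m → Fin n) λ a → Injective _≡_ _≡_ a × ∀ i → P (a i)

distinctElems-cong : ∀ {m} {P Q : Fin n → Set} → (∀ z → P z ⇔ Q z) → DistinctElems m P ⇔ DistinctElems m Q
distinctElems-cong P⇔Q = mk⇔ (λ (a , inj , Pa) → a , inj , λ i → to (P⇔Q (a i)) (Pa i))
                              (λ (a , inj , Qa) → a , inj , λ i → from (P⇔Q (a i)) (Qa i))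

distinctElems⇔≤∣∣ : ∀ m (p : Subset n) → DistinctElems m (_∈ p) ⇔ m ≤ ∣ p ∣
distinctElems⇔≤∣∣ m p = mk⇔
  (λ (a , inj , a∈p) → injective⇒≤ (λ {i} {j} eq → inj (index-injective (a∈p i) (a∈p j) eq)))
  (λ m≤∣p∣ → (λ i → enumerate p (inject≤ i m≤∣p∣))
           , (λ {i} {j} eq → inject≤-injective m≤∣p∣ m≤∣p∣ i j (enumerate-injective p eq))
           , λ i → enumerate-∈ p (inject≤ i m≤∣p∣))

n∸k≤n∸m⇔m≤k : ∀ {m k} → m ≤ n → n ∸ k ≤ n ∸ m ⇔ m ≤ k
n∸k≤n∸m⇔m≤k {n} m≤n = mk⇔ (λ le → ≮⇒≥ λ k<m → <⇒≱ (∸-monoʳ-< k<m m≤n) le) (∸-monoʳ-≤ n)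

n∸k≤∣∁p∣⇔∣p∣≤k : ∀ {k} (p : Subset n) → n ∸ k ≤ ∣ ∁ p ∣ ⇔ ∣ p ∣ ≤ k
n∸k≤∣∁p∣⇔∣p∣≤k {n} {k} p rewrite ∣∁p∣≡n∸∣p∣ p = n∸k≤n∸m⇔m≤k (∣p∣≤n p)

∈∁⇔∉ : ∀ {p : Subset n} {x} → x ∈ ∁ p ⇔ x ∉ p
∈∁⇔∉ = mk⇔ x∈∁p⇒x∉p x∉p⇒x∈∁p

∉∪⇔∉×∉ : ∀ (p q : Subset n) {x} → x ∉ p ∪ q ⇔ (x ∉ p × x ∉ q)
∉∪⇔∉×∉ p q = mk⇔ (λ x∉p∪q → x∉p∪q ∘ x∈p∪q⁺ ∘ inj₁ , x∉p∪q ∘ x∈p∪q⁺ ∘ inj₂)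
                 (λ (x∉p , x∉q) → (x∉p ¬-⊎ x∉q) ∘ x∈p∪q⁻ p q)

∈⇔lookup≡inside : ∀ {p : Subset n} {x} → x ∈ p ⇔ lookup p x ≡ inside
∈⇔lookup≡inside = mk⇔ []=⇒lookup (lookup⇒[]= _ _)

∈⇔∉∁ : ∀ {p : Subset n} {x} → x ∈ p ⇔ x ∉ ∁ p
∈⇔∉∁ = mk⇔ x∈p⇒x∉∁p x∉∁p⇒x∈p

∈tabulate⇔ : ∀ {f : Fin n → Bool} {x} → x ∈ tabulate f ⇔ f x ≡ inside
∈tabulate⇔ {f = f} {x} = ⇔-trans ∈⇔lookup≡inside
  (mk⇔ (trans (sym (lookup∘tabulate f x))) (trans (lookup∘tabulate f x)))

clip : ℕ → Subset n → Subset n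
clip k p with ∣ p ∣ ≤? k
... | yes _ = p
... | no  _ = ⊥

∣clip∣≤ : ∀ k (p : Subset n) → ∣ clip k p ∣ ≤ k
∣clip∣≤ {n} k p with ∣ p ∣ ≤? k
... | yes ∣p∣≤k = ∣p∣≤k
... | no  _     = subst (_≤ k) (sym (∣⊥∣≡0 n)) z≤n

clip-id : ∀ {k} {p : Subset n} → ∣ p ∣ ≤ k → clip k p ≡ p
clip-id {k = k} {p} ∣p∣≤k with ∣ p ∣ ≤? k
... | yes _     = refl
... | no  ∣p∣≰k = contradiction ∣p∣≤k ∣p∣≰k

NonArcSets : Digraph n → (Fin n → Subset n) → Set
NonArcSets D S = ∀ x z → Arc D x z ⇔ z ∉ S x

compAdj⇔∣∪∣≤ : ∀ k {D : Digraph n} {S} → NonArcSets D S → ∀ x y →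
  CompAdj (n ∸ k) D x y ⇔ (x ≢ y × ∣ S x ∪ S y ∣ ≤ k)
compAdj⇔∣∪∣≤ {n} k {D} {S} nonArc x y = begin
  (x ≢ y × DistinctElems (n ∸ k) (λ z → Arc D x z × Arc D y z))
    ∼⟨ ⇔-refl ×-⇔ distinctElems-cong commonArc⇔ ⟩
  (x ≢ y × DistinctElems (n ∸ k) (_∈ ∁ (S x ∪ S y)))
    ∼⟨ ⇔-refl ×-⇔ distinctElems⇔≤∣∣ (n ∸ k) (∁ (S x ∪ S y)) ⟩
  (x ≢ y × n ∸ k ≤ ∣ ∁ (S x ∪ S y) ∣)
    ∼⟨ ⇔-refl ×-⇔ n∸k≤∣∁p∣⇔∣p∣≤k (S x ∪ S y) ⟩
  (x ≢ y × ∣ S x ∪ S y ∣ ≤ k) ∎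
  where
  open EquationalReasoning
  commonArc⇔ : ∀ z → (Arc D x z × Arc D y z) ⇔ z ∈ ∁ (S x ∪ S y)
  commonArc⇔ z = begin
    (Arc D x z × Arc D y z)  ∼⟨ nonArc x z ×-⇔ nonArc y z ⟩
    (z ∉ S x × z ∉ S y)      ∼⟨ ⇔-sym (∉∪⇔∉×∉ (S x) (S y)) ⟩
    z ∉ S x ∪ S y            ∼⟨ ⇔-sym ∈∁⇔∉ ⟩
    z ∈ ∁ (S x ∪ S y)        ∎

PsiLabelling : ℕ → Graph n → (Fin n → Subset n) → Set
PsiLabelling k G S = ∀ x y → Adj G x y ⇔ (x ≢ y × ∣ S x ∪ S y ∣ ≤ k)

competitionGraph⇔psiLabelling : ∀ k (G : Graph n) →
  IsCompetitionGraph (n ∸ k) G ⇔ Σ (Fin n → Subset n) (PsiLabelling k G)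
competitionGraph⇔psiLabelling k G = mk⇔ labelling digraph
  where
  labelling : IsCompetitionGraph _ G → Σ _ (PsiLabelling k G)
  labelling (D , G≡C) = S , λ x y → ⇔-trans (G≡C x y) (compAdj⇔∣∪∣≤ k nonArc x y)
    where
    S : Fin _ → Subset _
    S x = ∁ (tabulate (D x))
    nonArc : NonArcSets D S
    nonArc x z = ⇔-trans (⇔-sym ∈tabulate⇔) ∈⇔∉∁

  digraph : Σ _ (PsiLabelling k G) → IsCompetitionGraph _ G
  digraph (S , lab) = D , λ x y → ⇔-trans (lab x y) (⇔-sym (compAdj⇔∣∪∣≤ k nonArc x y))
    where
    D : Digraph _
    D x = lookup (∁ (S x))
    nonArc : NonArcSets D S
    nonArc x z = ⇔-trans (⇔-sym ∈⇔lookup≡inside) ∈∁⇔∉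

module _ (G : Graph n) where

  closedNbr-refl : ∀ {x} → ClosedNbr G x x
  closedNbr-refl = inj₁ refl

  closedNbr-sym : ∀ {x y} → ClosedNbr G x y → ClosedNbr G y x
  closedNbr-sym (inj₁ refl) = inj₁ refl
  closedNbr-sym {x} {y} (inj₂ xy) = inj₂ (trans (Graph.sym G y x) xy)

  adj⇔≢×closedNbr : ∀ {x y} → Adj G x y ⇔ (x ≢ y × ClosedNbr G x y)
  adj⇔≢×closedNbr {x} = mk⇔ (λ xy → (λ { refl → contradiction (trans (sym xy) (irrefl G x)) λ () }) , inj₂ xy)
                            λ { (x≢y , inj₁ refl) → contradiction refl x≢y ; (_ , inj₂ xy) → xy }

  adj⇒≢ : ∀ {x y} → Adj G x y → x ≢ y
  adj⇒≢ = proj₁ ∘ to adj⇔≢×closedNbr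

  homogeneous-refl : ∀ {x} → Homogeneous G x x
  homogeneous-refl _ = ⇔-refl

  homogeneous-sym : ∀ {x y} → Homogeneous G x y → Homogeneous G y x
  homogeneous-sym x∼y w = ⇔-sym (x∼y w)

  homogeneous-trans : ∀ {x y z} → Homogeneous G x y → Homogeneous G y z → Homogeneous G x z
  homogeneous-trans x∼y y∼z w = ⇔-trans (x∼y w) (y∼z w)

  ¬homogeneous⇒≢ : ∀ {x y} → ¬ Homogeneous G x y → x ≢ y
  ¬homogeneous⇒≢ ¬x∼y refl = ¬x∼y homogeneous-refl

  closedNbr-resp : ∀ {x x′ y y′} → Homogeneous G x x′ → Homogeneous G y y′ →
    ClosedNbr G x y → ClosedNbr G x′ y′
  closedNbr-resp {x′ = x′} {y} x∼x′ y∼y′ =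
    closedNbr-sym ∘ to (y∼y′ x′) ∘ closedNbr-sym ∘ to (x∼x′ y)

  adj-resp : ∀ {x x′ y y′} → Homogeneous G x x′ → Homogeneous G y y′ → x′ ≢ y′ →
    Adj G x y → Adj G x′ y′
  adj-resp x∼x′ y∼y′ x′≢y′ xy =
    from adj⇔≢×closedNbr (x′≢y′ , closedNbr-resp x∼x′ y∼y′ (proj₂ (to adj⇔≢×closedNbr xy)))

  homogeneous⇒adj : ∀ {x y} → x ≢ y → Homogeneous G x y → Adj G x y
  homogeneous⇒adj x≢y x∼y = from adj⇔≢×closedNbr (x≢y , closedNbr-resp homogeneous-refl x∼y closedNbr-refl)

  closedNbr? : ∀ x y → Dec (ClosedNbr G x y)
  closedNbr? x y = (y ≟ x) ⊎-dec (adj G x y Bool.≟ true)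

  homogeneous? : ∀ x y → Dec (Homogeneous G x y)
  homogeneous? x y = all? λ w → closedNbr? x w ⇔? closedNbr? y w

  isRep? : ∀ v → Dec (IsRep G v)
  isRep? v = all? λ u → homogeneous? u v →-dec (toℕ v ≤? toℕ u)

  isRep-unique : ∀ {r r′} → IsRep G r → IsRep G r′ → Homogeneous G r r′ → r ≡ r′
  isRep-unique {r} {r′} rep rep′ r∼r′ =
    toℕ-injective (≤-antisym (rep r′ (homogeneous-sym r∼r′)) (rep′ r r∼r′))

  -- The IsRep proof is recomputed by the decision procedure, so that a class is
  -- determined by its representative up to ≡ (IsRep itself is a function type).
  canonicalClass : (r : Fin n) → IsRep G r → Class G
  canonicalClass r rep = r , toWitness (fromWitness {a? = isRep? r} rep)

  canonicalClass-cong : ∀ {r r′} (rep : IsRep G r) (rep′ : IsRep G r′) → r ≡ r′ →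
    canonicalClass r rep ≡ canonicalClass r′ rep′
  canonicalClass-cong {r} rep rep′ refl =
    cong (λ t → r , toWitness {a? = isRep? r} t) (T-irrelevant _ _)

  representative : (x : Fin n) → Σ (Fin n) λ r → Homogeneous G x r × IsRep G r
  representative x with leastWitness (Homogeneous G x) (homogeneous? x) homogeneous-refl
  ... | r , x∼r , minimal = r , x∼r , λ u u∼r → minimal u (homogeneous-trans x∼r (homogeneous-sym u∼r))

  classOf : Fin n → Class G
  classOf x = canonicalClass (proj₁ (representative x)) (proj₂ (proj₂ (representative x)))

  ∼classOf : ∀ x → Homogeneous G x (proj₁ (classOf x))
  ∼classOf x = proj₁ (proj₂ (representative x))

  classOf-cong : ∀ {x y} → Homogeneous G x y → classOf x ≡ classOf y
  classOf-cong {x} {y} x∼y = canonicalClass-cong _ _ (isRep-unique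
    (proj₂ (proj₂ (representative x))) (proj₂ (proj₂ (representative y)))
    (homogeneous-trans (homogeneous-sym (∼classOf x)) (homogeneous-trans x∼y (∼classOf y))))

  classOf-≢ : ∀ {x y} → ¬ Homogeneous G x y → proj₁ (classOf x) ≢ proj₁ (classOf y)
  classOf-≢ {x} {y} ¬x∼y = ¬homogeneous⇒≢ λ r∼r′ →
    ¬x∼y (homogeneous-trans (∼classOf x) (homogeneous-trans r∼r′ (homogeneous-sym (∼classOf y))))

  adj⇔condAdj : ∀ {x y} → ¬ Homogeneous G x y → Adj G x y ⇔ CondAdj G (classOf x) (classOf y)
  adj⇔condAdj {x} {y} ¬x∼y = mk⇔
    (λ xy → classOf-≢ ¬x∼y , adj-resp (∼classOf x) (∼classOf y) (classOf-≢ ¬x∼y) xy)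
    (λ (_ , rr′) → adj-resp (homogeneous-sym (∼classOf x)) (homogeneous-sym (∼classOf y))
                            (¬homogeneous⇒≢ ¬x∼y) rr′)

  connected⇒hasNeighbour : Connected G → ∀ {x y} → x ≢ y → Σ (Fin n) (Adj G x)
  connected⇒hasNeighbour conn {x} {y} x≢y with conn x y
  ... | here = contradiction refl x≢y
  ... | step {v = v} xv _ = v , xv

  nonHomogeneousNeighbour : Connected G → ∀ {x y} → ¬ Homogeneous G x y →
    Σ (Fin n) λ v → Adj G x v × ¬ Homogeneous G x v
  nonHomogeneousNeighbour conn {x} {y} = escape (conn x y) homogeneous-refl
    where
    escape : ∀ {a b} → Reach G a b → Homogeneous G x a → ¬ Homogeneous G x b →
      Σ (Fin n) λ v → Adj G x v × ¬ Homogeneous G x v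
    escape here x∼a ¬x∼b = contradiction x∼a ¬x∼b
    escape (step {v = v} av walk) x∼a ¬x∼b with homogeneous? x v
    ... | yes x∼v = escape walk x∼v ¬x∼b
    ... | no ¬x∼v = v , adj-resp (homogeneous-sym x∼a) homogeneous-refl (¬homogeneous⇒≢ ¬x∼v) av , ¬x∼v

  module _ {k} {S : Fin n → Subset n} (lab : PsiLabelling k G S) where

    adj⇒∣label∣≤ : ∀ {x v} → Adj G x v → ∣ S x ∣ ≤ k
    adj⇒∣label∣≤ {x} {v} xv = ≤-trans (∣p∣≤∣p∪q∣ (S x) (S v)) (proj₂ (to (lab x v) xv))

    closedNbr⇔∣∪∣≤ : ∀ {x} → ∣ S x ∣ ≤ k → ∀ w → ClosedNbr G x w ⇔ ∣ S x ∪ S w ∣ ≤ k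
    closedNbr⇔∣∪∣≤ {x} ∣Sx∣≤k w = mk⇔
      (λ { (inj₁ refl) → subst (λ p → ∣ p ∣ ≤ k) (sym (∪-idem (S x))) ∣Sx∣≤k
         ; (inj₂ xw) → proj₂ (to (lab x w) xw) })
      fromBound
      where
      fromBound : ∣ S x ∪ S w ∣ ≤ k → ClosedNbr G x w
      fromBound le with w ≟ x
      ... | yes w≡x = inj₁ w≡x
      ... | no w≢x = inj₂ (from (lab x w) ((λ x≡w → w≢x (sym x≡w)) , le))

    sameLabel⇒homogeneous : ∀ {x y} → ∣ S x ∣ ≤ k → S x ≡ S y → Homogeneous G x y
    sameLabel⇒homogeneous {x} {y} ∣Sx∣≤k Sx≡Sy w = begin
      ClosedNbr G x w    ∼⟨ closedNbr⇔∣∪∣≤ ∣Sx∣≤k w ⟩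
      ∣ S x ∪ S w ∣ ≤ k  ≡⟨ cong (λ p → ∣ p ∪ S w ∣ ≤ k) Sx≡Sy ⟩
      ∣ S y ∪ S w ∣ ≤ k  ∼⟨ ⇔-sym (closedNbr⇔∣∪∣≤ (subst (λ p → ∣ p ∣ ≤ k) Sx≡Sy ∣Sx∣≤k) w) ⟩
      ClosedNbr G y w    ∎
      where open EquationalReasoning

  psiLabelling⇒condEmbedsInPsi : ∀ {k} → Connected G →
    Σ (Fin n → Subset n) (PsiLabelling k G) → CondEmbedsInPsi G k
  psiLabelling⇒condEmbedsInPsi {k} conn (S , lab) = ψ , ψ-injective , ψ-adj
    where
    ψ : Class G → Subset n
    ψ (r , _) = S r

    ψ-injective : ∀ c d → ψ c ≡ ψ d → proj₁ c ≡ proj₁ d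
    ψ-injective (r , rep) (r′ , rep′) Sr≡Sr′ with r ≟ r′
    ... | yes r≡r′ = r≡r′
    ... | no r≢r′ = isRep-unique rep rep′ (sameLabel⇒homogeneous {S = S} lab ∣Sr∣≤k Sr≡Sr′)
      where
      ∣Sr∣≤k : ∣ S r ∣ ≤ k
      ∣Sr∣≤k = adj⇒∣label∣≤ {S = S} lab (proj₂ (connected⇒hasNeighbour conn r≢r′))

    ψ-adj : ∀ c d → CondAdj G c d ⇔ PsiAdj n k (ψ c) (ψ d)
    ψ-adj c d = mk⇔
      (λ (r≢r′ , rr′) → r≢r′ ∘ ψ-injective c d , proj₂ (to (lab _ _) rr′))
      (λ (ψc≢ψd , le) → let r≢r′ = ψc≢ψd ∘ cong S in r≢r′ , from (lab _ _) (r≢r′ , le))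

  condEmbedsInPsi⇒psiLabelling : ∀ {k} → Connected G → CondEmbedsInPsi G k →
    Σ (Fin n → Subset n) (PsiLabelling k G)
  condEmbedsInPsi⇒psiLabelling {k} conn (ψ , ψ-injective , ψ-adj) = S , lab
    where
    label : Fin n → Subset n
    label x = ψ (classOf x)

    -- A class without neighbours in G/∼ (only possible when G is complete) may
    -- have a label with more than k elements.
    S : Fin n → Subset n
    S x = clip k (label x)

    ∣label∣≤ : ∀ {x y} → ¬ Homogeneous G x y → ∣ label x ∣ ≤ k
    ∣label∣≤ {x} ¬x∼y =
      let v , xv , ¬x∼v = nonHomogeneousNeighbour conn ¬x∼y
      in ≤-trans (∣p∣≤∣p∪q∣ (label x) (label v))
                 (proj₂ (to (ψ-adj (classOf x) (classOf v)) (to (adj⇔condAdj ¬x∼v) xv)))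

    label-≢ : ∀ {x y} → ¬ Homogeneous G x y → label x ≢ label y
    label-≢ ¬x∼y = classOf-≢ ¬x∼y ∘ ψ-injective _ _

    homogeneousCase : ∀ {x y} → Homogeneous G x y → Adj G x y ⇔ (x ≢ y × ∣ S x ∪ S y ∣ ≤ k)
    homogeneousCase {x} {y} x∼y =
      mk⇔ (λ xy → adj⇒≢ xy , ∣Sx∪Sy∣≤k) (λ (x≢y , _) → homogeneous⇒adj x≢y x∼y)
      where
      ∣Sx∪Sy∣≤k : ∣ S x ∪ S y ∣ ≤ k
      ∣Sx∪Sy∣≤k = subst (λ c → ∣ S x ∪ clip k (ψ c) ∣ ≤ k) (classOf-cong x∼y)
        (subst (λ p → ∣ p ∣ ≤ k) (sym (∪-idem (S x))) (∣clip∣≤ k (label x)))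

    nonHomogeneousCase : ∀ {x y} → ¬ Homogeneous G x y → Adj G x y ⇔ (x ≢ y × ∣ S x ∪ S y ∣ ≤ k)
    nonHomogeneousCase {x} {y} ¬x∼y = begin
      Adj G x y                          ∼⟨ adj⇔condAdj ¬x∼y ⟩
      CondAdj G (classOf x) (classOf y)  ∼⟨ ψ-adj _ _ ⟩
      PsiAdj n k (label x) (label y)     ∼⟨ ×⇔proj₂ (label-≢ ¬x∼y) ⟩
      ∣ label x ∪ label y ∣ ≤ k          ≡⟨ cong₂ (λ p q → ∣ p ∪ q ∣ ≤ k) Sx≡ Sy≡ ⟨
      ∣ S x ∪ S y ∣ ≤ k                  ∼⟨ ⇔-sym (×⇔proj₂ (¬homogeneous⇒≢ ¬x∼y)) ⟩
      (x ≢ y × ∣ S x ∪ S y ∣ ≤ k)        ∎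
      where
      open EquationalReasoning
      Sx≡ : S x ≡ label x
      Sx≡ = clip-id (∣label∣≤ ¬x∼y)
      Sy≡ : S y ≡ label y
      Sy≡ = clip-id (∣label∣≤ (¬x∼y ∘ homogeneous-sym))

    lab : PsiLabelling k G S
    lab x y = [ homogeneousCase {x} {y} , nonHomogeneousCase ]′ (toSum (homogeneous? x y))

  psiLabelling⇔condEmbedsInPsi : ∀ {k} → Connected G →
    Σ (Fin n → Subset n) (PsiLabelling k G) ⇔ CondEmbedsInPsi G k
  psiLabelling⇔condEmbedsInPsi conn =
    mk⇔ (psiLabelling⇒condEmbedsInPsi conn) (condEmbedsInPsi⇒psiLabelling conn)

mainTheorem6 : (n k : ℕ) (G : Graph n) → Connected G → k < n →
    IsCompetitionGraph (n ∸ k) G ⇔ CondEmbedsInPsi G k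
mainTheorem6 n k G conn _ =
  ⇔-trans (competitionGraph⇔psiLabelling k G) (psiLabelling⇔condEmbedsInPsi G conn)
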